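{- Let $F=(n_F)_{n\ge 1}$ be a sequence belonging to the family $\mathcal{T}_\lambda$. Then $F$ is a cobweb tiling sequence. That is, $F$ is admissible, and for all integers $1\le k\le n$, with $m=n-k+1$, the $F$-box $V_{m,n}=[k_F]\times[(k+1)_F]\times\cdots\times[n_F]$ admits a tiling.
   Context: Here $\mathbb{N}=\{1,2,3,\dots\}$. The family $\mathcal{T}_\lambda$ consists of all sequences $F=(n_F)_{n\ge1}$ of positive integers (with $1_F\in\mathbb{N}$) for which there are coefficients $\lambda_K(k,m),\lambda_M(k,m)\in\mathbb{N}\cup\{0\}$ satisfying $(k+m)_F=\lambda_K(k,m)\,k_F+\lambda_M(k,m)\,m_F$ for all $k,m\in\mathbb{N}$. Notation: $n_F!=n_F\cdot(n-1)_F\cdots 1_F$, with $0_F!=1$. The $F$-nomial coefficient is $\binom{n}{m}_F=\frac{n_F!}{m_F!\,(n-m)_F!}$ for $n\ge m\ge 0$. $F$ is called admissible if $\binom{n}{m}_F\in\mathbb{N}\cup\{0\}$ for all integers $n\ge m\ge 0$. $F$-boxes: for $s\ge1$ write $[s_F]=\{1,2,\dots,s_F\}$. For integers $1\le k\le n$ and $m=n-k+1$, the $F$-box is $V_{m,n}=[k_F]\times[(k+1)_F]\times\cdots\times[n_F]\subseteq\mathbb{N}^m$. A sub-box of the form $\sigma V_m$ is a set $A_1\times\cdots\times A_m$ such that $A_s\subseteq[(k+s-1)_F]$ and $|A_s|=(\sigma(s))_F$ for $s=1,\dots,m$, where $\sigma$ is some permutation of $\{1,\dots,m\}$. A tiling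 of $V_{m,n}$ is a partition of $V_{m,n}$ into pairwise disjoint sub-boxes, each of the form $\sigma V_m$; the permutation $\sigma$ may differ from one sub-box to another. Equivalently, a tiling is a partition of the set of maximal paths of the cobweb layer $\langle\Phi_k\to\Phi_n\rangle$, where $\Phi_s=\{1,\dots,s_F\}$, into maximal-path sets of blocks of the form $\sigma P_m$. A cobweb tiling sequence is an admissible sequence $F$ such that $V_{m,n}$ has a tiling for all $1\le k\le n$. -}

module Defs where

open import Data.Nat using (ℕ; zero; suc; _+_; _*_; _∸_; _≤_; _<_)
open import Data.Nat.Divisibility using (_∣_)
open import Data.Fin using (Fin; toℕ)
open import Data.Fin.Subset using (Subset; _∈_; ∣_∣)
open import Data.Fin.Permutation using (Permutation′; _⟨$⟩ʳ_)
open import Data.Product using (Σ; ∃; _×_; _,_)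
open import Relation.Binary.PropositionalEquality using (_≡_)

-- A sequence F = (n_F)_{n ≥ 1} is modelled as F : ℕ → ℕ, where F n = n_F
-- for n ≥ 1; the value F 0 is never used.

Positive : (ℕ → ℕ) → Set
Positive F = ∀ n → 1 ≤ n → 0 < F n

InTλ : (ℕ → ℕ) → Set
InTλ F = Positive F ×
  Σ (ℕ → ℕ → ℕ) λ λK → Σ (ℕ → ℕ → ℕ) λ λM →
    ∀ k m → 1 ≤ k → 1 ≤ m → F (k + m) ≡ λK k m * F k + λM k m * F m

_F! : (ℕ → ℕ) → ℕ → ℕ
(F F!) zero = 1
(F F!) (suc n) = F (suc n) * (F F!) n

-- Admissibility: the F-nomial n_F! / (m_F! (n-m)_F!) is in ℕ ∪ {0},
-- i.e. the denominator divides the numerator.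
Admissible : (ℕ → ℕ) → Set
Admissible F = ∀ n m → m ≤ n → (F F!) m * (F F!) (n ∸ m) ∣ (F F!) n

-- The F-box V_{m,n} for 1 ≤ k ≤ n, m = n - k + 1 = suc (n ∸ k).
-- Coordinate s ∈ Fin m (0-based) corresponds to paper coordinate s+1 and
-- ranges over [(k+s)_F], encoded 0-based as Fin (F (k + s)).
dim : ℕ → ℕ → ℕ
dim k n = suc (n ∸ k)

Point : (ℕ → ℕ) → ℕ → ℕ → Set
Point F k n = (s : Fin (dim k n)) → Fin (F (k + toℕ s))

-- A sub-box of the form σV_m: sets A_s ⊆ [(k+s-1)_F] with |A_s| = (σ(s))_F.
-- (0-based: paper value σ(s+1) = suc (toℕ (σ ⟨$⟩ʳ s)).)
record SubBox (F : ℕ → ℕ) (k n : ℕ) : Set where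
  field
    σ     : Permutation′ (dim k n)
    A     : (s : Fin (dim k n)) → Subset (F (k + toℕ s))
    sizes : ∀ s → ∣ A s ∣ ≡ F (suc (toℕ (σ ⟨$⟩ʳ s)))

_∈Box_ : ∀ {F k n} → Point F k n → SubBox F k n → Set
x ∈Box B = ∀ s → x s ∈ SubBox.A B s

Tiling : (ℕ → ℕ) → ℕ → ℕ → Set
Tiling F k n =
  Σ ℕ λ t → Σ (Fin t → SubBox F k n) λ tiles →
    ∀ (x : Point F k n) →
      Σ (Fin t) λ i → (x ∈Box tiles i) × (∀ j → x ∈Box tiles j → j ≡ i)

CobwebTiling : (ℕ → ℕ) → Set
CobwebTiling F = Admissible F × (∀ k n → 1 ≤ k → k ≤ n → Tiling F k n)

module Submission where

-- The box with sides (k+1)_F, …, (k+m)_F is tiled by rearrangements of the box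
-- with sides 1_F, …, m_F.  Cut it along its longest side (k+m)_F = λK k_F + λM m_F
-- into λK slabs of width k_F and λM slabs of width m_F: a slab of the first kind
-- is, after rotating the axes, the box with sides k_F, …, (k+m-1)_F, and one of
-- the second kind is a prism m_F × (box with sides (k+1)_F, …, (k+m-1)_F); both
-- are tiled by induction.  The same splitting of the top factor of
-- (j+m)_F ⋯ (j+1)_F shows by induction on (m, j) that m_F! divides this product,
-- which is admissibility since (j+m)_F! = (j+m)_F ⋯ (j+1)_F · j_F!.

open import Defs
open import Data.Nat using (ℕ; zero; suc; _+_; _*_; _∸_; _≤_; _<_; z≤n; s≤s; _≤?_; _<?_)
open import Data.Nat.Properties
open import Algebra.Properties.CommutativeSemigroup *-commutativeSemigroup using (x∙yz≈y∙xz)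
open import Data.Nat.Divisibility
  using (_∣_; ∣-refl; ∣-reflexive; ∣m∣n⇒∣m+n; ∣n⇒∣m*n; *-monoʳ-∣; *-pres-∣)
open import Data.Fin using (Fin; toℕ; opposite) renaming (zero to fz; suc to fs)
open import Data.Fin.Properties using (all?; toℕ<n; toℕ-fromℕ; toℕ-inject₁; opposite-involutive)
open import Data.Fin.Permutation
  using (Permutation′; _⟨$⟩ʳ_; _⟨$⟩ˡ_; inverseʳ; inverseˡ; _∘ₚ_; lift₀; transpose; reverse)
  renaming (id to idₚ)
open import Data.Fin.Subset using (Subset; inside; outside; _∈_; ∣_∣)
open import Data.Vec using (_∷_; []; here; there)
open import Data.Vec.Functional using (Vector; tail) renaming (_∷_ to _◂_)
open import Data.List using (List; []; _∷_; _++_; map; length; lookup)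
open import Data.List.Relation.Unary.All as All using (All; []; _∷_)
open import Data.List.Relation.Unary.All.Properties using (map⁺; ++⁺)
open import Data.List.Membership.Propositional.Properties using (∈-lookup)
open import Data.Product using (Σ; _×_; _,_; proj₁; proj₂) renaming (map to map-×)
open import Data.Empty using (⊥-elim)
open import Function using (_∘_)
open import Level using (0ℓ)
open import Relation.Nullary using (yes; no; ¬_)
open import Relation.Nullary.Decidable using (_×-dec_)
open import Relation.Unary using (Pred; Decidable; ∁)
open import Relation.Binary.PropositionalEquality

module _ {A : Set} {P : Pred A 0ℓ} (P? : Decidable P) where

  count : List A → ℕ
  count [] = 0
  count (a ∷ as) with P? a
  ... | yes _ = suc (count as)
  ... | no _  = count as

  count-++ : ∀ as bs → count (as ++ bs) ≡ count as + count bs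
  count-++ [] bs = refl
  count-++ (a ∷ as) bs with P? a
  ... | yes _ = cong suc (count-++ as bs)
  ... | no _  = count-++ as bs

  count-none : ∀ {as} → All (∁ P) as → count as ≡ 0
  count-none [] = refl
  count-none {a ∷ _} (¬pa ∷ ¬pas) with P? a
  ... | yes pa = ⊥-elim (¬pa pa)
  ... | no _   = count-none ¬pas

  count-singleton : ∀ {a} → P a → count (a ∷ []) ≡ 1
  count-singleton {a} pa with P? a
  ... | yes _   = refl
  ... | no ¬pa = ⊥-elim (¬pa pa)

  count≡0⇒none : ∀ as → count as ≡ 0 → ∀ j → ¬ P (lookup as j)
  count≡0⇒none (a ∷ as) c j pa with P? a
  count≡0⇒none (a ∷ as) () j pa    | yes _
  count≡0⇒none (a ∷ as) c fz pa    | no ¬pa = ¬pa pa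
  count≡0⇒none (a ∷ as) c (fs j) pa | no _  = count≡0⇒none as c j pa

  count≡1⇒unique : ∀ as → count as ≡ 1 →
    Σ (Fin (length as)) λ i → P (lookup as i) × (∀ j → P (lookup as j) → j ≡ i)
  count≡1⇒unique (a ∷ as) c with P? a
  ... | yes pa = fz , pa , unique
    where
    unique : ∀ j → P (lookup (a ∷ as) j) → j ≡ fz
    unique fz     _  = refl
    unique (fs j) pj = ⊥-elim (count≡0⇒none as (suc-injective c) j pj)
  ... | no ¬pa with count≡1⇒unique as c
  ...   | i , pi , u = fs i , pi , unique
    where
    unique : ∀ j → P (lookup (a ∷ as) j) → j ≡ fs i
    unique fz     pj = ⊥-elim (¬pa pj)
    unique (fs j) pj = cong fs (u j pj)

count-map : ∀ {A B : Set} {P : Pred B 0ℓ} {Q : Pred A 0ℓ} (P? : Decidable P) (Q? : Decidable Q)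
  (f : A → B) → (∀ a → P (f a) → Q a) → (∀ a → Q a → P (f a)) →
  ∀ as → count P? (map f as) ≡ count Q? as
count-map P? Q? f to from [] = refl
count-map P? Q? f to from (a ∷ as) with P? (f a) | Q? a
... | yes _   | yes _   = cong suc (count-map P? Q? f to from as)
... | yes pfa | no ¬qa  = ⊥-elim (¬qa (to a pfa))
... | no ¬pfa | yes qa  = ⊥-elim (¬pfa (from a qa))
... | no _    | no _    = count-map P? Q? f to from as

record Block (m : ℕ) : Set where
  constructor block
  field
    σ      : Permutation′ m
    corner : Vector ℕ m

InBlock : ∀ {m} → Vector ℕ m → Vector ℕ m → Block m → Set
InBlock e x (block σ c) = ∀ s → c s ≤ x s × x s < c s + e (σ ⟨$⟩ʳ s)

inBlock? : ∀ {m} (e x : Vector ℕ m) → Decidable (InBlock e x)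
inBlock? e x (block σ c) = all? λ s → (c s ≤? x s) ×-dec (x s <? c s + e (σ ⟨$⟩ʳ s))

Fits : ∀ {m} → Vector ℕ m → Vector ℕ m → Block m → Set
Fits e d (block σ c) = ∀ s → c s + e (σ ⟨$⟩ʳ s) ≤ d s

InBox : ∀ {m} → Vector ℕ m → Vector ℕ m → Set
InBox d x = ∀ s → x s < d s

-- Exactness of the cover is stated by counting: counts add up along concatenated
-- block lists and are invariant under moving the blocks together with the point.
record BoxTiling {m} (e d : Vector ℕ m) : Set where
  constructor tiling
  field
    blocks : List (Block m)
    fit    : All (Fits e d) blocks
    exact  : ∀ x → InBox d x → count (inBlock? e x) blocks ≡ 1

record Rearrangement {m} (d′ d : Vector ℕ m) : Set where
  constructor rearrangement
  field
    π     : Permutation′ m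
    d′≡dπ : ∀ s → d′ s ≡ d (π ⟨$⟩ʳ s)

≗⇒rearrangement : ∀ {m} {d′ d : Vector ℕ m} → d′ ≗ d → Rearrangement d′ d
≗⇒rearrangement eq = rearrangement idₚ eq

rearrangement-trans : ∀ {m} {d₁ d₂ d₃ : Vector ℕ m} →
  Rearrangement d₁ d₂ → Rearrangement d₂ d₃ → Rearrangement d₁ d₃
rearrangement-trans (rearrangement π eq₁) (rearrangement ρ eq₂) =
  rearrangement (π ∘ₚ ρ) λ s → trans (eq₁ s) (eq₂ (π ⟨$⟩ʳ s))

rearrangement-cons : ∀ {m} {d′ d : Vector ℕ m} w →
  Rearrangement d′ d → Rearrangement (w ◂ d′) (w ◂ d)
rearrangement-cons w (rearrangement π eq) = rearrangement (lift₀ π) λ { fz → refl ; (fs s) → eq s }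

rearrangement-swap : ∀ {m} a b (r : Vector ℕ m) → Rearrangement (a ◂ b ◂ r) (b ◂ a ◂ r)
rearrangement-swap a b r =
  rearrangement (transpose fz (fs fz)) λ { fz → refl ; (fs fz) → refl ; (fs (fs s)) → refl }

retile : ∀ {m} {e d d′ : Vector ℕ m} → Rearrangement d′ d → BoxTiling e d → BoxTiling e d′
retile {m} {e} {d} {d′} (rearrangement π d′≡dπ) (tiling bs fit exact) =
  tiling (map move bs) (map⁺ (All.map (λ {B} → fits-move {B}) fit)) exact′
  where
  move : Block m → Block m
  move (block σ c) = block (π ∘ₚ σ) (c ∘ (π ⟨$⟩ʳ_))

  fits-move : ∀ {B} → Fits e d B → Fits e d′ (move B)
  fits-move {block σ c} f s =
    subst (c (π ⟨$⟩ʳ s) + e (σ ⟨$⟩ʳ (π ⟨$⟩ʳ s)) ≤_) (sym (d′≡dπ s)) (f (π ⟨$⟩ʳ s))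

  exact′ : ∀ x → InBox d′ x → count (inBlock? e x) (map move bs) ≡ 1
  exact′ x x∈d′ = trans (count-map (inBlock? e x) (inBlock? e x′) move to from bs) (exact x′ x′∈d)
    where
    x′ : Vector ℕ m
    x′ = x ∘ (π ⟨$⟩ˡ_)

    x′∈d : InBox d x′
    x′∈d t =
      subst (x′ t <_) (trans (d′≡dπ (π ⟨$⟩ˡ t)) (cong d (inverseʳ π))) (x∈d′ (π ⟨$⟩ˡ t))

    to : ∀ B → InBlock e x (move B) → InBlock e x′ B
    to (block σ c) x∈ t =
      subst (λ u → c u ≤ x′ t × x′ t < c u + e (σ ⟨$⟩ʳ u)) (inverseʳ π) (x∈ (π ⟨$⟩ˡ t))

    from : ∀ B → InBlock e x′ B → InBlock e x (move B)
    from (block σ c) x′∈ s =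
      subst (λ u → c (π ⟨$⟩ʳ s) ≤ x u × x u < c (π ⟨$⟩ʳ s) + e (σ ⟨$⟩ʳ (π ⟨$⟩ʳ s)))
        (inverseˡ π) (x′∈ (π ⟨$⟩ʳ s))

singleBlockTiling : ∀ {m} {e d : Vector ℕ m} → Rearrangement d e → BoxTiling e d
singleBlockTiling {e = e} {d} (rearrangement π d≡eπ) = tiling (block π (λ _ → 0) ∷ [])
  ((λ s → ≤-reflexive (sym (d≡eπ s))) ∷ [])
  (λ x x∈d → count-singleton (inBlock? e x) λ s → z≤n , subst (x s <_) (d≡eπ s) (x∈d s))

prismTiling : ∀ {m} {e d : Vector ℕ m} w → BoxTiling e d → BoxTiling (w ◂ e) (w ◂ d)
prismTiling {m} {e} {d} w (tiling bs fit exact) =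
  tiling (map extend bs) (map⁺ (All.map (λ {B} → fits-extend {B}) fit)) exact′
  where
  extend : Block m → Block (suc m)
  extend (block σ c) = block (lift₀ σ) (0 ◂ c)

  fits-extend : ∀ {B} → Fits e d B → Fits (w ◂ e) (w ◂ d) (extend B)
  fits-extend f fz     = ≤-refl
  fits-extend f (fs s) = f s

  exact′ : ∀ x → InBox (w ◂ d) x → count (inBlock? (w ◂ e) x) (map extend bs) ≡ 1
  exact′ x x∈ = trans (count-map (inBlock? (w ◂ e) x) (inBlock? e (tail x)) extend to from bs)
                      (exact (tail x) (x∈ ∘ fs))
    where
    to : ∀ B → InBlock (w ◂ e) x (extend B) → InBlock e (tail x) B
    to (block σ c) x∈B = x∈B ∘ fs

    from : ∀ B → InBlock e (tail x) B → InBlock (w ◂ e) x (extend B)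
    from (block σ c) x∈B fz     = z≤n , x∈ fz
    from (block σ c) x∈B (fs s) = x∈B s

module _ {w y : ℕ} (w≤y : w ≤ y) (c l : ℕ) where

  private
    y≡w+[y∸w] : y ≡ w + (y ∸ w)
    y≡w+[y∸w] = sym (m+[n∸m]≡n w≤y)

  ∸-pres-interval : w + c ≤ y × y < w + c + l → c ≤ y ∸ w × y ∸ w < c + l
  ∸-pres-interval (lo , hi) =
    +-cancelˡ-≤ w c (y ∸ w) (subst (w + c ≤_) y≡w+[y∸w] lo) ,
    +-cancelˡ-< w (y ∸ w) (c + l) (subst₂ _<_ y≡w+[y∸w] (+-assoc w c l) hi)

  ∸-reflect-interval : c ≤ y ∸ w × y ∸ w < c + l → w + c ≤ y × y < w + c + l
  ∸-reflect-interval (lo , hi) =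
    subst (w + c ≤_) (sym y≡w+[y∸w]) (+-monoʳ-≤ w lo) ,
    subst₂ _<_ (sym y≡w+[y∸w]) (sym (+-assoc w c l)) (+-monoʳ-< w hi)

stackTiling : ∀ {m} {e : Vector ℕ (suc m)} {w₁ w₂ : ℕ} {r : Vector ℕ m} →
  BoxTiling e (w₁ ◂ r) → BoxTiling e (w₂ ◂ r) → BoxTiling e (w₁ + w₂ ◂ r)
stackTiling {m} {e} {w₁} {w₂} {r} (tiling bs₁ fit₁ exact₁) (tiling bs₂ fit₂ exact₂) =
  tiling (bs₁ ++ map lift bs₂)
    (++⁺ (All.map (λ {B} → fits-low {B}) fit₁) (map⁺ (All.map (λ {B} → fits-lift {B}) fit₂)))
    exact
  where
  lift : Block (suc m) → Block (suc m)
  lift (block σ c) = block σ ((w₁ + c fz) ◂ tail c)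

  fits-low : ∀ {B} → Fits e (w₁ ◂ r) B → Fits e (w₁ + w₂ ◂ r) B
  fits-low f fz     = ≤-trans (f fz) (m≤m+n w₁ w₂)
  fits-low f (fs s) = f (fs s)

  fits-lift : ∀ {B} → Fits e (w₂ ◂ r) B → Fits e (w₁ + w₂ ◂ r) (lift B)
  fits-lift {block σ c} f fz     =
    subst (_≤ w₁ + w₂) (sym (+-assoc w₁ (c fz) _)) (+-monoʳ-≤ w₁ (f fz))
  fits-lift f (fs s) = f (fs s)

  exact : ∀ x → InBox (w₁ + w₂ ◂ r) x → count (inBlock? e x) (bs₁ ++ map lift bs₂) ≡ 1
  exact x x∈ with x fz <? w₁
  ... | yes low = trans (count-++ (inBlock? e x) bs₁ _) (cong₂ _+_ (exact₁ x x∈low) none₂)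
    where
    x∈low : InBox (w₁ ◂ r) x
    x∈low fz     = low
    x∈low (fs s) = x∈ (fs s)

    none₂ : count (inBlock? e x) (map lift bs₂) ≡ 0
    none₂ = count-none (inBlock? e x) (map⁺ (All.universal ∉lift bs₂))
      where
      ∉lift : ∀ B → ¬ InBlock e x (lift B)
      ∉lift (block σ c) x∈B = <⇒≱ low (m+n≤o⇒m≤o w₁ (proj₁ (x∈B fz)))
  ... | no ¬low = trans (count-++ (inBlock? e x) bs₁ _) (cong₂ _+_ none₁ lowered)
    where
    w₁≤x : w₁ ≤ x fz
    w₁≤x = ≮⇒≥ ¬low

    x′ : Vector ℕ (suc m)
    x′ = (x fz ∸ w₁) ◂ tail x

    x′∈high : InBox (w₂ ◂ r) x′
    x′∈high fz     = subst (x fz ∸ w₁ <_) (m+n∸m≡n w₁ w₂) (∸-monoˡ-< (x∈ fz) w₁≤x)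
    x′∈high (fs s) = x∈ (fs s)

    none₁ : count (inBlock? e x) bs₁ ≡ 0
    none₁ = count-none (inBlock? e x) (All.map (λ {B} → ∉low {B}) fit₁)
      where
      ∉low : ∀ {B} → Fits e (w₁ ◂ r) B → ¬ InBlock e x B
      ∉low {block σ c} f x∈B = ¬low (<-≤-trans (proj₂ (x∈B fz)) (f fz))

    lowered : count (inBlock? e x) (map lift bs₂) ≡ 1
    lowered = trans (count-map (inBlock? e x) (inBlock? e x′) lift to from bs₂) (exact₂ x′ x′∈high)
      where
      to : ∀ B → InBlock e x (lift B) → InBlock e x′ B
      to (block σ c) x∈B fz     = ∸-pres-interval w₁≤x (c fz) _ (x∈B fz)
      to (block σ c) x∈B (fs s) = x∈B (fs s)

      from : ∀ B → InBlock e x′ B → InBlock e x (lift B)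
      from (block σ c) x′∈B fz     = ∸-reflect-interval w₁≤x (c fz) _ (x′∈B fz)
      from (block σ c) x′∈B (fs s) = x′∈B (fs s)

replicateTiling : ∀ {m} {e : Vector ℕ (suc m)} {w : ℕ} {r : Vector ℕ m} →
  ∀ n → BoxTiling e (w ◂ r) → BoxTiling e (n * w ◂ r)
replicateTiling zero    t = tiling [] [] λ x x∈ → ⊥-elim (n≮0 (x∈ fz))
replicateTiling (suc n) t = stackTiling t (replicateTiling n t)

descending : (ℕ → ℕ) → (m : ℕ) → Vector ℕ m
descending f zero    = λ ()
descending f (suc m) = f m ◂ descending f m

descending-cong : ∀ {f g} → f ≗ g → ∀ m → descending f m ≗ descending g m
descending-cong f≗g (suc m) fz     = f≗g m
descending-cong f≗g (suc m) (fs s) = descending-cong f≗g m s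

descending-opposite : ∀ f m (s : Fin m) → descending f m s ≡ f (toℕ (opposite s))
descending-opposite f (suc m) fz     = cong f (sym (toℕ-fromℕ m))
descending-opposite f (suc m) (fs s) =
  trans (descending-opposite f m s) (cong f (sym (toℕ-inject₁ (opposite s))))

descending-rotate : ∀ f m → Rearrangement (f 0 ◂ descending (f ∘ suc) m) (descending f (suc m))
descending-rotate f zero    = ≗⇒rearrangement λ { fz → refl }
descending-rotate f (suc m) =
  rearrangement-trans (rearrangement-swap (f 0) (f (suc m)) (descending (f ∘ suc) m))
                      (rearrangement-cons (f (suc m)) (descending-rotate f m))

interval : ∀ {N} → ℕ → ℕ → Subset N
interval {zero}  _        _         = []
interval {suc N} (suc lo) len       = outside ∷ interval lo len
interval {suc N} zero     zero      = outside ∷ interval 0 0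
interval {suc N} zero     (suc len) = inside ∷ interval 0 len

∣interval∣ : ∀ {N} lo len → lo + len ≤ N → ∣ interval {N} lo len ∣ ≡ len
∣interval∣ {zero}  zero     zero      _  = refl
∣interval∣ {suc N} (suc lo) len       le = ∣interval∣ lo len (≤-pred le)
∣interval∣ {suc N} zero     zero      _  = ∣interval∣ {N} 0 0 z≤n
∣interval∣ {suc N} zero     (suc len) le = cong suc (∣interval∣ 0 len (≤-pred le))

∈interval⇒ : ∀ {N} lo len (x : Fin N) → x ∈ interval lo len → lo ≤ toℕ x × toℕ x < lo + len
∈interval⇒ (suc lo) len       fz     ()
∈interval⇒ (suc lo) len       (fs x) (there x∈) = map-× s≤s s≤s (∈interval⇒ lo len x x∈)
∈interval⇒ zero     zero      fz     ()
∈interval⇒ zero     zero      (fs x) (there x∈) = ⊥-elim (n≮0 (proj₂ (∈interval⇒ 0 0 x x∈)))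
∈interval⇒ zero     (suc len) fz     here       = z≤n , s≤s z≤n
∈interval⇒ zero     (suc len) (fs x) (there x∈) = z≤n , s≤s (proj₂ (∈interval⇒ 0 len x x∈))

⇒∈interval : ∀ {N} lo len (x : Fin N) → lo ≤ toℕ x → toℕ x < lo + len → x ∈ interval lo len
⇒∈interval (suc lo) len       (fs x) (s≤s lo≤x) (s≤s x<) = there (⇒∈interval lo len x lo≤x x<)
⇒∈interval zero     zero      x      _          x<0      = ⊥-elim (n≮0 x<0)
⇒∈interval zero     (suc len) fz     _          _        = here
⇒∈interval zero     (suc len) (fs x) _          (s≤s x<) = there (⇒∈interval 0 len x z≤n x<)

boxTiling⇒tiling : ∀ {F k n} {e : Vector ℕ (dim k n)} (ρ : Permutation′ (dim k n)) →
  (∀ i → e i ≡ F (suc (toℕ (ρ ⟨$⟩ʳ i)))) → BoxTiling e (λ s → F (k + toℕ s)) → Tiling F k n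
boxTiling⇒tiling {F} {k} {n} {e} ρ e≡Fρ (tiling bs fit exact) =
  length bs , tile , unique
  where
  m = dim k n

  subBox : (B : Block m) → Fits e (λ s → F (k + toℕ s)) B → SubBox F k n
  subBox (block σ c) f = record
    { σ     = σ ∘ₚ ρ
    ; A     = λ s → interval (c s) (e (σ ⟨$⟩ʳ s))
    ; sizes = λ s → trans (∣interval∣ (c s) _ (f s)) (e≡Fρ (σ ⟨$⟩ʳ s))
    }

  fit-at : ∀ i → Fits e (λ s → F (k + toℕ s)) (lookup bs i)
  fit-at i = All.lookup fit (∈-lookup i)

  tile : Fin (length bs) → SubBox F k n
  tile i = subBox (lookup bs i) (fit-at i)

  unique : (x : Point F k n) →
    Σ (Fin (length bs)) λ i → (x ∈Box tile i) × (∀ j → x ∈Box tile j → j ≡ i)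
  unique x with count≡1⇒unique (inBlock? e (toℕ ∘ x)) bs (exact (toℕ ∘ x) (toℕ<n ∘ x))
  ... | i , x∈i , only-i =
    i , from (lookup bs i) (fit-at i) x∈i , λ j x∈j → only-i j (to (lookup bs j) (fit-at j) x∈j)
    where
    to : ∀ B f → x ∈Box subBox B f → InBlock e (toℕ ∘ x) B
    to (block σ c) f x∈ s = ∈interval⇒ (c s) _ (x s) (x∈ s)

    from : ∀ B f → InBlock e (toℕ ∘ x) B → x ∈Box subBox B f
    from (block σ c) f x∈ s = ⇒∈interval (c s) _ (x s) (proj₁ (x∈ s)) (proj₂ (x∈ s))

fallingProduct : (ℕ → ℕ) → ℕ → ℕ → ℕ
fallingProduct F j zero    = 1
fallingProduct F j (suc m) = F (j + suc m) * fallingProduct F j m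

F!-split : ∀ F j m → (F F!) (j + m) ≡ fallingProduct F j m * (F F!) j
F!-split F j zero    = trans (cong (F F!) (+-identityʳ j)) (sym (*-identityˡ _))
F!-split F j (suc m) = begin
  (F F!) (j + suc m)
    ≡⟨ cong (F F!) (+-suc j m) ⟩
  F (suc (j + m)) * (F F!) (j + m)
    ≡⟨ cong₂ _*_ (cong F (sym (+-suc j m))) (F!-split F j m) ⟩
  F (j + suc m) * (fallingProduct F j m * (F F!) j)
    ≡⟨ sym (*-assoc (F (j + suc m)) _ _) ⟩
  fallingProduct F j (suc m) * (F F!) j
    ∎
  where open ≡-Reasoning

fallingProduct-zero : ∀ F m → fallingProduct F 0 m ≡ (F F!) m
fallingProduct-zero F zero    = refl
fallingProduct-zero F (suc m) = cong (F (suc m) *_) (fallingProduct-zero F m)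

fallingProduct-suc : ∀ F j m → F (suc j) * fallingProduct F (suc j) m ≡ fallingProduct F j (suc m)
fallingProduct-suc F j zero    = cong (λ i → F i * 1) (+-comm 1 j)
fallingProduct-suc F j (suc m) = begin
  F (suc j) * (F (suc j + suc m) * q)
    ≡⟨ x∙yz≈y∙xz (F (suc j)) (F (suc j + suc m)) q ⟩
  F (suc j + suc m) * (F (suc j) * q)
    ≡⟨ cong₂ _*_ (cong F (sym (+-suc j (suc m)))) (fallingProduct-suc F j m) ⟩
  fallingProduct F j (suc (suc m))
    ∎
  where
  open ≡-Reasoning
  q = fallingProduct F (suc j) m

module _ (F : ℕ → ℕ) (λK λM : ℕ → ℕ → ℕ)
  (split : ∀ k m → 1 ≤ k → 1 ≤ m → F (k + m) ≡ λK k m * F k + λM k m * F m) where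

  private
    a b : ℕ → ℕ → ℕ
    a k m = λK (suc k) (suc m)
    b k m = λM (suc k) (suc m)

    split⁺ : ∀ k m → F (suc k + suc m) ≡ a k m * F (suc k) + b k m * F (suc m)
    split⁺ k m = split (suc k) (suc m) (s≤s z≤n) (s≤s z≤n)

  -- sides k m = ((k+m)_F, …, (k+1)_F) are the side lengths of V_{m,k+m} in reverse order.
  sides : ℕ → (m : ℕ) → Vector ℕ m
  sides k = descending (λ i → F (suc k + i))

  sides-rotate : ∀ k m → Rearrangement (F (suc k) ◂ sides (suc k) m) (sides k (suc m))
  sides-rotate k m = rearrangement-trans (≗⇒rearrangement shift) (descending-rotate _ m)
    where
    shift : F (suc k) ◂ sides (suc k) m ≗ F (suc k + 0) ◂ descending (λ i → F (suc k + suc i)) m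
    shift fz     = cong (F ∘ suc) (sym (+-identityʳ k))
    shift (fs s) = descending-cong (λ i → cong (F ∘ suc) (sym (+-suc k i))) m s

  sidesTiling : ∀ m k → BoxTiling (sides 0 m) (sides k m)
  sidesTiling m       zero    = singleBlockTiling (≗⇒rearrangement λ _ → refl)
  sidesTiling zero    (suc k) = singleBlockTiling (≗⇒rearrangement λ ())
  sidesTiling (suc m) (suc k) = retile (≗⇒rearrangement longest-side)
    (stackTiling (replicateTiling (a k m) (retile (sides-rotate k m) (sidesTiling (suc m) k)))
                 (replicateTiling (b k m) (prismTiling (F (suc m)) (sidesTiling m (suc k)))))
    where
    longest-side : sides (suc k) (suc m) ≗ (a k m * F (suc k) + b k m * F (suc m)) ◂ sides (suc k) m
    longest-side fz     = trans (cong (F ∘ suc) (sym (+-suc k m))) (split⁺ k m)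
    longest-side (fs s) = refl

  F-boxTiling : ∀ k n → 1 ≤ k → k ≤ n → Tiling F k n
  F-boxTiling (suc k) n _ _ = boxTiling⇒tiling reverse (descending-opposite (F ∘ suc) m)
    (retile (rearrangement reverse reversed) (sidesTiling m k))
    where
    m = dim (suc k) n
    reversed : ∀ s → F (suc k + toℕ s) ≡ sides k m (opposite s)
    reversed s = sym (trans (descending-opposite _ m (opposite s))
                            (cong (λ t → F (suc k + toℕ t)) (opposite-involutive s)))

  F!∣fallingProduct : ∀ m j → (F F!) m ∣ fallingProduct F j m
  F!∣fallingProduct zero    j       = ∣-refl
  F!∣fallingProduct (suc m) zero    = ∣-reflexive (sym (fallingProduct-zero F (suc m)))
  F!∣fallingProduct (suc m) (suc j) = subst ((F F!) (suc m) ∣_) (sym expand)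
    (∣m∣n⇒∣m+n (∣n⇒∣m*n (a j m) (F!∣fallingProduct (suc m) j))
               (∣n⇒∣m*n (b j m) (*-monoʳ-∣ (F (suc m)) (F!∣fallingProduct m (suc j)))))
    where
    q = fallingProduct F (suc j) m
    expand : fallingProduct F (suc j) (suc m) ≡
             a j m * fallingProduct F j (suc m) + b j m * (F (suc m) * q)
    expand = begin
      F (suc j + suc m) * q
        ≡⟨ cong (_* q) (split⁺ j m) ⟩
      (a j m * F (suc j) + b j m * F (suc m)) * q
        ≡⟨ *-distribʳ-+ q (a j m * F (suc j)) _ ⟩
      a j m * F (suc j) * q + b j m * F (suc m) * q
        ≡⟨ cong₂ _+_ (*-assoc (a j m) _ q) (*-assoc (b j m) _ q) ⟩
      a j m * (F (suc j) * q) + b j m * (F (suc m) * q)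
        ≡⟨ cong (λ t → a j m * t + b j m * (F (suc m) * q)) (fallingProduct-suc F j m) ⟩
      a j m * fallingProduct F j (suc m) + b j m * (F (suc m) * q)
        ∎
      where open ≡-Reasoning

  admissible : Admissible F
  admissible n m m≤n = subst (λ t → (F F!) m * (F F!) (n ∸ m) ∣ (F F!) t) (m∸n+n≡m m≤n)
    (subst ((F F!) m * (F F!) (n ∸ m) ∣_) (sym (F!-split F (n ∸ m) m))
      (*-pres-∣ (F!∣fallingProduct m (n ∸ m)) ∣-refl))

theorem1 : (F : ℕ → ℕ) → InTλ F → CobwebTiling F
theorem1 F (_ , λK , λM , split) = admissible F λK λM split , F-boxTiling F λK λM split
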